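{- For any graph $G$ whose number of vertices is a power of $2$, $\mathrm{opt}(R[G])\leq O(|V(G)|^2\log|V(G)|)$.
   Context: For $|V(G)|=2^k$ with vertices assigned distinct strings $\mathrm{enc}(u)\in\{0,1\}^k$, $R[G]$ consists of positive samples $\{\mathrm{enc}(u)1\mathrm{enc}(u)^R: u\in V(G)\}$ and negative samples $\{\mathrm{enc}(u)1\mathrm{enc}(v)^R: uv\in E(G)\}$, where $x^R$ is the reversal of $x$. A DFA over $\{0,1\}$ is canonical if its state diagram has exactly $\ell$ layers for some $\ell$, every path from the initial state to any sink has length exactly $\ell$, and all accepting states lie in the last layer. $\mathrm{opt}(R[G])$ is the minimum number of states of a canonical DFA accepting all positive and rejecting all negative samples. -}

module Defs where

open import Data.Nat using (ℕ; zero; suc; _≤_; _^_)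
open import Data.Fin using (Fin; toℕ)
open import Data.Bool using (Bool; true; false)
open import Data.List using (List; []; _∷_; _++_; reverse; length; [_])
open import Data.Vec using (Vec; toList)
open import Data.Maybe using (Maybe; just; nothing)
open import Data.Product using (Σ; ∃; _×_; _,_)
open import Relation.Nullary using (¬_)
open import Relation.Binary.PropositionalEquality using (_≡_)
open import Function.Definitions using (Injective)
open import Level using (0ℓ)

record Graph (n : ℕ) : Set₁ where
  field
    Adj   : Fin n → Fin n → Set
    sym   : ∀ {u v} → Adj u v → Adj v u
    irrefl : ∀ {u} → ¬ Adj u u

-- (Partial) DFAs over {0,1} (false = 0, true = 1) with m states Fin m.
-- A missing transition means the run dies (word rejected).

record DFA (m : ℕ) : Set₁ where
  field
    init   : Fin m
    δ      : Fin m → Bool → Maybe (Fin m)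
    accept : Fin m → Set

  run : Fin m → List Bool → Maybe (Fin m)
  run q []       = just q
  run q (b ∷ w) with δ q b
  ... | nothing = nothing
  ... | just q' = run q' w

  Accepts : List Bool → Set
  Accepts w = Σ (Fin m) λ q → (run init w ≡ just q) × accept q

  Rejects : List Bool → Set
  Rejects w = ¬ Accepts w

  IsSink : Fin m → Set
  IsSink q = ∀ b → δ q b ≡ nothing

record Canonical {m : ℕ} (A : DFA m) : Set where
  open DFA A
  field
    ℓ          : ℕ
    layer      : Fin m → Fin (suc ℓ)
    init-layer : toℕ (layer init) ≡ 0
    step-layer : ∀ q b q' → δ q b ≡ just q' → toℕ (layer q') ≡ suc (toℕ (layer q))
    sink-depth : ∀ w q → run init w ≡ just q → IsSink q → length w ≡ ℓ
    acc-last   : ∀ q → accept q → toℕ (layer q) ≡ ℓ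

Word : Set
Word = List Bool

sampleWord : ∀ {k} → Vec Bool k → Vec Bool k → Word
sampleWord x y = toList x ++ (true ∷ reverse (toList y))

Consistent : ∀ {k m} → Graph (2 ^ k) → (Fin (2 ^ k) → Vec Bool k) → DFA m → Set
Consistent G enc A =
  (∀ u → DFA.Accepts A (sampleWord (enc u) (enc u))) ×
  (∀ u v → Graph.Adj G u v → DFA.Rejects A (sampleWord (enc u) (enc v)))

OptAtMost : ∀ {k} → Graph (2 ^ k) → (Fin (2 ^ k) → Vec Bool k) → ℕ → Set₁
OptAtMost G enc B =
  Σ ℕ λ m → (m ≤ B) × Σ (DFA m) λ A → Canonical A × Consistent G enc A

-- A single graph-independent DFA suffices: it accepts exactly the words x1y^R with |x| = |y| = k and
-- x = y. It reads x into a k-bit register (last bit first), skips the separator 1, and then checks the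
-- bits of y^R against the register one by one. Its states are (layer, register) pairs, so it is
-- canonical with 2k+2 layers and (2k+2)·2^k = O(n log n) states; negative samples are rejected because
-- G is loopless and enc is injective.
module Submission where

open import Defs
open import Data.Nat using (ℕ; _≤_; _*_; _^_)
open import Data.Fin using (Fin)
open import Data.Bool using (Bool)
open import Data.Vec using (Vec)
open import Data.Product using (Σ)
open import Function.Definitions using (Injective)
open import Relation.Binary.PropositionalEquality using (_≡_)

open import Data.Nat using (suc; _+_; _<_; _≟_; s≤s)
open import Data.Nat.Properties
open import Data.Nat.Tactic.RingSolver using (solve-∀)
open import Data.Fin using (toℕ; lower₁; combine; remQuot) renaming (zero to 0F; suc to sucF)
open import Data.Fin.Base using (funToFin; finToFun)
open import Data.Fin.Properties
  using (toℕ-lower₁; remQuot-combine; finToFun-funToFin; 2↔Bool)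
open import Data.Bool using (true; false; if_then_else_)
open import Data.Vec using ([]; _∷_; _∷ʳ_; toList; replicate; lookup; tabulate)
open import Data.Vec.Properties
  using (length-toList; toList-∷ʳ; toList-injective; cast-is-id; tabulate-cong; tabulate∘lookup)
open import Data.List using (List; []; _∷_; _++_; [_]; length; reverse; _ʳ++_)
open import Data.List.Properties using (length-++; length-reverse; reverse-injective)
open import Data.List.Relation.Binary.Prefix.Heterogeneous using (Prefix; []; _∷_; _++ᵖ_)
open import Data.List.Relation.Binary.Prefix.Heterogeneous.Properties using (toPointwise)
open import Data.List.Relation.Binary.Pointwise using (Pointwise-≡⇒≡)
open import Data.Maybe using (Maybe; just; nothing; _>>=_)
import Data.Maybe as Maybe
open import Data.Maybe.Properties using (map-just)
open import Data.Product using (∃; ∃₂; _×_; _,_; proj₁; proj₂)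
open import Function using (_∘_)
open import Function.Bundles using (Inverse)
open import Relation.Binary using (tri<; tri≈; tri>)
open import Relation.Nullary using (yes; no; contradiction)
open import Relation.Binary.PropositionalEquality
  using (refl; sym; trans; cong; cong₂; subst; module ≡-Reasoning)

map-just⁻ : ∀ {A B : Set} (f : A → B) {mx : Maybe A} {y : B} →
            Maybe.map f mx ≡ just y → ∃ λ x → mx ≡ just x × f x ≡ y
map-just⁻ f {just x} refl = x , refl , refl

map-nothing⁻ : ∀ {A B : Set} {f : A → B} {mx : Maybe A} → Maybe.map f mx ≡ nothing → mx ≡ nothing
map-nothing⁻ {mx = nothing} refl = refl

module _ {m : ℕ} (A : DFA m) where
  open DFA A

  run-∷ : ∀ {q q′ b} w → δ q b ≡ just q′ → run q (b ∷ w) ≡ run q′ w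
  run-∷ {q} {b = b} w eq with δ q b
  run-∷ w refl | just _ = refl

  run-∷⁻ : ∀ {q r b} w → run q (b ∷ w) ≡ just r →
           ∃ λ q′ → δ q b ≡ just q′ × run q′ w ≡ just r
  run-∷⁻ {q} {b = b} w eq with δ q b
  ... | just q′ = q′ , refl , eq

  run-layer : (layer : Fin m → ℕ) → (∀ q b q′ → δ q b ≡ just q′ → layer q′ ≡ suc (layer q)) →
              ∀ {q r} w → run q w ≡ just r → layer r ≡ layer q + length w
  run-layer layer step-layer {q} [] refl = sym (+-identityʳ (layer q))
  run-layer layer step-layer {q} (b ∷ w) eq with run-∷⁻ w eq
  ... | q′ , δq , runq′ = begin
    layer _                    ≡⟨ run-layer layer step-layer w runq′ ⟩
    layer q′ + length w        ≡⟨ cong (_+ length w) (step-layer q b q′ δq) ⟩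
    suc (layer q) + length w   ≡⟨ +-suc (layer q) (length w) ⟨
    layer q + suc (length w)   ∎
    where open ≡-Reasoning

prefix-of-length : ∀ {as bs : List Bool} → Prefix _≡_ as bs → length as ≡ length bs → as ≡ bs
prefix-of-length p eq = Pointwise-≡⇒≡ (toPointwise eq p)

prefix-∷ʳ⁻ : ∀ {as bs : List Bool} {c} → Prefix _≡_ as (bs ++ [ c ]) → length as ≤ length bs →
             Prefix _≡_ as bs
prefix-∷ʳ⁻ {bs = []}    []       _         = []
prefix-∷ʳ⁻ {bs = _ ∷ _} []       _         = []
prefix-∷ʳ⁻ {bs = _ ∷ _} (eq ∷ p) (s≤s le) = eq ∷ prefix-∷ʳ⁻ p le

length≤length-ʳ++ : ∀ (xs ys : List Bool) → length ys ≤ length (xs ʳ++ ys)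
length≤length-ʳ++ []       ys = ≤-refl
length≤length-ʳ++ (x ∷ xs) ys = ≤-trans (n≤1+n (length ys)) (length≤length-ʳ++ xs (x ∷ ys))

-- An n-bit register used as a stack with its top at the front: push drops the bottom bit and pop
-- refills the bottom with false.
push : ∀ {n} → Bool → Vec Bool n → Vec Bool n
push b []      = []
push b (c ∷ v) = b ∷ push c v

pushAll : ∀ {n} → List Bool → Vec Bool n → Vec Bool n
pushAll []       v = v
pushAll (b ∷ bs) v = pushAll bs (push b v)

push-prefix : ∀ {n} {l} b (v : Vec Bool n) → Prefix _≡_ l (toList v) → length l < n →
              Prefix _≡_ (b ∷ l) (toList (push b v))
push-prefix b (c ∷ v) []         _         = refl ∷ []
push-prefix b (c ∷ v) (refl ∷ p) (s≤s lt) = refl ∷ push-prefix c v p lt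

pushAll-prefix : ∀ {n} {l} bs (v : Vec Bool n) → Prefix _≡_ l (toList v) → length (bs ʳ++ l) ≤ n →
                 Prefix _≡_ (bs ʳ++ l) (toList (pushAll bs v))
pushAll-prefix          []       v p _  = p
pushAll-prefix {l = l} (b ∷ bs) v p le =
  pushAll-prefix bs (push b v) (push-prefix b v p (≤-trans (length≤length-ʳ++ bs (b ∷ l)) le)) le

pop : ∀ {n} → Bool → Vec Bool n → Maybe (Vec Bool n)
pop _     []          = just []
pop false (false ∷ v) = just (v ∷ʳ false)
pop true  (true  ∷ v) = just (v ∷ʳ false)
pop _     (_     ∷ _) = nothing

popAll : ∀ {n} → List Bool → Vec Bool n → Maybe (Vec Bool n)
popAll []       v = just v
popAll (b ∷ bs) v = pop b v >>= popAll bs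

pop-top : ∀ {n} b (v : Vec Bool n) → pop b (b ∷ v) ≡ just (v ∷ʳ false)
pop-top false v = refl
pop-top true  v = refl

pop-just⁻ : ∀ {n} b c (v : Vec Bool n) {u} → pop b (c ∷ v) ≡ just u → b ≡ c × u ≡ v ∷ʳ false
pop-just⁻ false false v refl = refl , refl
pop-just⁻ true  true  v refl = refl , refl

popAll-prefix : ∀ {n} bs (v : Vec Bool n) → Prefix _≡_ bs (toList v) → ∃ λ u → popAll bs v ≡ just u
popAll-prefix []       v       []         = v , refl
popAll-prefix (b ∷ bs) (b ∷ v) (refl ∷ p) rewrite pop-top b v =
  popAll-prefix bs (v ∷ʳ false) (subst (Prefix _≡_ bs) (sym (toList-∷ʳ false v)) (p ++ᵖ [ false ]))

popAll-prefix⁻ : ∀ {n} bs (v : Vec Bool n) {u} → popAll bs v ≡ just u → length bs ≤ n →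
                 Prefix _≡_ bs (toList v)
popAll-prefix⁻ []       v       _  _ = []
popAll-prefix⁻ (b ∷ bs) (c ∷ v) eq (s≤s le) with pop b (c ∷ v) in popped
... | just u with pop-just⁻ b c v popped
...   | refl , refl = refl ∷ prefix-∷ʳ⁻ below (subst (length bs ≤_) (sym (length-toList v)) le)
  where
  below : Prefix _≡_ bs (toList v ++ [ false ])
  below = subst (Prefix _≡_ bs) (toList-∷ʳ false v)
            (popAll-prefix⁻ bs (v ∷ʳ false) eq (≤-trans le (n≤1+n _)))

encodeBits : ∀ {n} → Vec Bool n → Fin (2 ^ n)
encodeBits v = funToFin (Inverse.from 2↔Bool ∘ lookup v)

decodeBits : ∀ {n} → Fin (2 ^ n) → Vec Bool n
decodeBits j = tabulate (Inverse.to 2↔Bool ∘ finToFun j)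

decodeBits-encodeBits : ∀ {n} (v : Vec Bool n) → decodeBits (encodeBits v) ≡ v
decodeBits-encodeBits v = begin
  tabulate (to ∘ finToFun (funToFin (from ∘ lookup v)))
    ≡⟨ tabulate-cong (cong to ∘ finToFun-funToFin (from ∘ lookup v)) ⟩
  tabulate (to ∘ from ∘ lookup v)
    ≡⟨ tabulate-cong (strictlyInverseˡ ∘ lookup v) ⟩
  tabulate (lookup v)
    ≡⟨ tabulate∘lookup v ⟩
  v ∎
  where
  open ≡-Reasoning
  open Inverse 2↔Bool

steps : ∀ {R : Set} → (ℕ → R → Bool → Maybe R) → ℕ → R → List Bool → Maybe R
steps step i x []      = just x
steps step i x (b ∷ w) = step i x b >>= λ y → steps step (suc i) y w

steps-∷ : ∀ {R : Set} {step : ℕ → R → Bool → Maybe R} {i x y b} w → step i x b ≡ just y →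
          steps step i x (b ∷ w) ≡ steps step (suc i) y w
steps-∷ {step = step} {i} w eq = cong (λ my → my >>= λ y → steps step (suc i) y w) eq

module LayeredAutomaton
  {R : Set} {r : ℕ} (encodeR : R → Fin r) (decodeR : Fin r → R)
  (decodeR-encodeR : ∀ x → decodeR (encodeR x) ≡ x)
  (ℓ : ℕ) (step : ℕ → R → Bool → Maybe R) (start : R) where

  State : Set
  State = Fin (suc ℓ) × R

  encode : State → Fin (suc ℓ * r)
  encode (i , x) = combine i (encodeR x)

  decode : Fin (suc ℓ * r) → State
  decode q = let (i , j) = remQuot r q in i , decodeR j

  decode-encode : ∀ s → decode (encode s) ≡ s
  decode-encode (i , x) = begin
    decode (combine i (encodeR x)) ≡⟨ cong (λ (i , j) → i , decodeR j) (remQuot-combine i (encodeR x)) ⟩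
    i , decodeR (encodeR x)        ≡⟨ cong (i ,_) (decodeR-encodeR x) ⟩
    i , x                          ∎
    where open ≡-Reasoning

  move : State → Bool → Maybe State
  move (i , x) b with ℓ ≟ toℕ i
  ... | yes _   = nothing
  ... | no ℓ≢i = Maybe.map (sucF (lower₁ i ℓ≢i) ,_) (step (toℕ i) x b)

  move⁻ : ∀ i x b {j y} → move (i , x) b ≡ just (j , y) →
          toℕ j ≡ suc (toℕ i) × step (toℕ i) x b ≡ just y
  move⁻ i x b eq with ℓ ≟ toℕ i
  ... | no ℓ≢i with map-just⁻ (sucF (lower₁ i ℓ≢i) ,_) {step (toℕ i) x b} eq
  ...   | _ , stepped , refl = cong suc (toℕ-lower₁ i ℓ≢i) , stepped

  move-just : ∀ i x b {y} → toℕ i < ℓ → step (toℕ i) x b ≡ just y →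
              ∃ λ j → move (i , x) b ≡ just (j , y)
  move-just i x b i<ℓ stepped with ℓ ≟ toℕ i
  ... | yes ℓ≡i = contradiction (sym ℓ≡i) (<⇒≢ i<ℓ)
  ... | no ℓ≢i  = _ , map-just stepped

  move-dead : (∀ i x → ∃₂ λ b y → step i x b ≡ just y) →
              ∀ i x → (∀ b → move (i , x) b ≡ nothing) → toℕ i ≡ ℓ
  move-dead live i x dead with ℓ ≟ toℕ i
  ... | yes ℓ≡i = sym ℓ≡i
  ... | no ℓ≢i with live (toℕ i) x
  ...   | b , _ , stepped with () ← trans (sym (dead b)) (map-just stepped)

  layer : Fin (suc ℓ * r) → ℕ
  layer q = toℕ (proj₁ (decode q))

  automaton : DFA (suc ℓ * r)
  automaton = record
    { init   = encode (0F , start)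
    ; δ      = λ q b → Maybe.map encode (move (decode q) b)
    ; accept = λ q → layer q ≡ ℓ
    }

  open DFA automaton

  layer-encode : ∀ s → layer (encode s) ≡ toℕ (proj₁ s)
  layer-encode s = cong (toℕ ∘ proj₁) (decode-encode s)

  δ-encode : ∀ s b → δ (encode s) b ≡ Maybe.map encode (move s b)
  δ-encode s b = cong (λ s → Maybe.map encode (move s b)) (decode-encode s)

  layer-step : ∀ q b q′ → δ q b ≡ just q′ → layer q′ ≡ suc (layer q)
  layer-step q b q′ eq with map-just⁻ encode {move (decode q) b} eq
  ... | (j , y) , moved , refl = trans (layer-encode (j , y)) (proj₁ (move⁻ _ _ b moved))

  run-layer-init : ∀ {q} w → run init w ≡ just q → layer q ≡ length w
  run-layer-init w ran =
    trans (run-layer automaton layer layer-step w ran) (cong (_+ length w) (layer-encode (0F , start)))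

  run-encode : ∀ w i x {y} → toℕ i + length w ≤ ℓ → steps step (toℕ i) x w ≡ just y →
               ∃ λ j → run (encode (i , x)) w ≡ just (encode (j , y))
  run-encode []      i x _ refl = i , refl
  run-encode (b ∷ w) i x le ran
    with step (toℕ i) x b in stepped | subst (_≤ ℓ) (+-suc (toℕ i) (length w)) le
  ... | just x′ | le′ with move-just i x b (m+n≤o⇒m≤o (suc (toℕ i)) le′) stepped
  ...   | j , moved =
    let j≡1+i = proj₁ (move⁻ i x b moved)
        j′ , ran′ = run-encode w j x′ (subst (λ t → t + length w ≤ ℓ) (sym j≡1+i) le′)
                      (subst (λ t → steps step t x′ w ≡ just _) (sym j≡1+i) ran)
    in j′ , trans (run-∷ automaton w (trans (δ-encode (i , x) b) (map-just moved))) ran′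

  run-encode⁻ : ∀ w i x {q} → run (encode (i , x)) w ≡ just q →
                ∃ λ y → steps step (toℕ i) x w ≡ just y
  run-encode⁻ []      i x _   = x , refl
  run-encode⁻ (b ∷ w) i x ran with run-∷⁻ automaton w ran
  ... | q′ , δq , ran′ with map-just⁻ encode {move (i , x) b} (trans (sym (δ-encode (i , x) b)) δq)
  ...   | (j , x′) , moved , refl with move⁻ i x b moved
  ...     | j≡1+i , stepped with run-encode⁻ w j x′ ran′
  ...       | y , steps≡ =
    y , trans (steps-∷ w stepped) (subst (λ t → steps step t x′ w ≡ just y) j≡1+i steps≡)

  accepts : ∀ w {y} → length w ≡ ℓ → steps step 0 start w ≡ just y → Accepts w
  accepts w len ran with run-encode w 0F start (≤-reflexive len) ran
  ... | j , ran′ = _ , ran′ , trans (run-layer-init w ran′) len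

  accepts⁻ : ∀ w → Accepts w → ∃ λ y → steps step 0 start w ≡ just y
  accepts⁻ w (_ , ran , _) = run-encode⁻ w 0F start ran

  canonical : (∀ i x → ∃₂ λ b y → step i x b ≡ just y) → Canonical automaton
  canonical live = record
    { ℓ          = ℓ
    ; layer      = proj₁ ∘ decode
    ; init-layer = layer-encode (0F , start)
    ; step-layer = layer-step
    ; sink-depth = λ w q ran sink →
        trans (sym (run-layer-init w ran))
              (move-dead live (proj₁ (decode q)) (proj₂ (decode q)) (map-nothing⁻ ∘ sink))
    ; acc-last   = λ _ accepted → accepted
    }

toList-injective′ : ∀ {n} {xs ys : Vec Bool n} → toList xs ≡ toList ys → xs ≡ ys
toList-injective′ {xs = xs} {ys} eq = trans (sym (cast-is-id refl xs)) (toList-injective refl xs ys eq)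

length-reverse-toList : ∀ {n} (v : Vec Bool n) → length (reverse (toList v)) ≡ n
length-reverse-toList v = trans (length-reverse (toList v)) (length-toList v)

module Palindrome (k : ℕ) where

  step : ℕ → Vec Bool k → Bool → Maybe (Vec Bool k)
  step i v b with <-cmp i k
  ... | tri< _ _ _ = just (push b v)
  ... | tri≈ _ _ _ = if b then just v else nothing
  ... | tri> _ _ _ = pop b v

  step-push : ∀ {i} v b → i < k → step i v b ≡ just (push b v)
  step-push {i} v b i<k with <-cmp i k
  ... | tri< _ _ _    = refl
  ... | tri≈ i≮k _ _ = contradiction i<k i≮k
  ... | tri> i≮k _ _ = contradiction i<k i≮k

  step-separator : ∀ v → step k v true ≡ just v
  step-separator v with <-cmp k k
  ... | tri< _ k≢k _ = contradiction refl k≢k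
  ... | tri≈ _ _ _    = refl
  ... | tri> _ k≢k _ = contradiction refl k≢k

  step-pop : ∀ {i} v b → k < i → step i v b ≡ pop b v
  step-pop {i} v b k<i with <-cmp i k
  ... | tri< _ _ k≮i = contradiction k<i k≮i
  ... | tri≈ _ _ k≮i = contradiction k<i k≮i
  ... | tri> _ _ _    = refl

  step-live : ∀ i v → ∃₂ λ b u → step i v b ≡ just u
  step-live i v with <-cmp i k | v
  ... | tri< _ _ _ | _     = true , _ , refl
  ... | tri≈ _ _ _ | _     = true , _ , refl
  ... | tri> _ _ _ | []    = true , _ , refl
  ... | tri> _ _ _ | c ∷ u = c , _ , pop-top c u

  steps-push : ∀ bs i v w → i + length bs ≤ k →
               steps step i v (bs ++ w) ≡ steps step (i + length bs) (pushAll bs v) w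
  steps-push []       i v w _  = cong (λ t → steps step t v w) (sym (+-identityʳ i))
  steps-push (b ∷ bs) i v w le = begin
    steps step i v (b ∷ bs ++ w)
      ≡⟨ steps-∷ (bs ++ w) (step-push v b i<k) ⟩
    steps step (suc i) (push b v) (bs ++ w)
      ≡⟨ steps-push bs (suc i) (push b v) w le′ ⟩
    steps step (suc i + length bs) (pushAll bs (push b v)) w
      ≡⟨ cong (λ t → steps step t (pushAll bs (push b v)) w) (+-suc i (length bs)) ⟨
    steps step (i + suc (length bs)) (pushAll bs (push b v)) w
      ∎
    where
    open ≡-Reasoning
    le′ : suc i + length bs ≤ k
    le′ = subst (_≤ k) (+-suc i (length bs)) le
    i<k : i < k
    i<k = m+n≤o⇒m≤o (suc i) le′

  steps-pop : ∀ bs i v → k < i → steps step i v bs ≡ popAll bs v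
  steps-pop []       i v _   = refl
  steps-pop (b ∷ bs) i v k<i rewrite step-pop v b k<i with pop b v
  ... | nothing = refl
  ... | just u  = steps-pop bs (suc i) u (m<n⇒m<1+n k<i)

  start : Vec Bool k
  start = replicate k false

  load : Vec Bool k → Vec Bool k
  load x = pushAll (toList x) start

  load-prefix : ∀ x → Prefix _≡_ (reverse (toList x)) (toList (load x))
  load-prefix x = pushAll-prefix (toList x) start [] (≤-reflexive (length-reverse-toList x))

  steps-sampleWord : ∀ x y →
    steps step 0 start (sampleWord x y) ≡ popAll (reverse (toList y)) (load x)
  steps-sampleWord x y = begin
    steps step 0 start (toList x ++ true ∷ reverse (toList y))
      ≡⟨ steps-push (toList x) 0 start _ (≤-reflexive (length-toList x)) ⟩
    steps step (length (toList x)) (load x) (true ∷ reverse (toList y))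
      ≡⟨ cong (λ t → steps step t (load x) (true ∷ reverse (toList y))) (length-toList x) ⟩
    steps step k (load x) (true ∷ reverse (toList y))
      ≡⟨ steps-∷ (reverse (toList y)) (step-separator (load x)) ⟩
    steps step (suc k) (load x) (reverse (toList y))
      ≡⟨ steps-pop (reverse (toList y)) (suc k) (load x) (n<1+n k) ⟩
    popAll (reverse (toList y)) (load x)
      ∎
    where open ≡-Reasoning

  length-sampleWord : ∀ (x y : Vec Bool k) → length (sampleWord x y) ≡ k + suc k
  length-sampleWord x y = begin
    length (toList x ++ true ∷ reverse (toList y))
      ≡⟨ length-++ (toList x) ⟩
    length (toList x) + suc (length (reverse (toList y)))
      ≡⟨ cong₂ _+_ (length-toList x) (cong suc (length-reverse-toList y)) ⟩
    k + suc k
      ∎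
    where open ≡-Reasoning

  open LayeredAutomaton encodeBits decodeBits decodeBits-encodeBits (k + suc k) step start
    using (automaton; accepts; accepts⁻; canonical)
    public

  accepts-diagonal : ∀ x → DFA.Accepts automaton (sampleWord x x)
  accepts-diagonal x =
    accepts (sampleWord x x) (length-sampleWord x x)
      (trans (steps-sampleWord x x) (proj₂ (popAll-prefix (reverse (toList x)) (load x) (load-prefix x))))

  accepts⇒≡ : ∀ x y → DFA.Accepts automaton (sampleWord x y) → x ≡ y
  accepts⇒≡ x y accepted with accepts⁻ (sampleWord x y) accepted
  ... | _ , ran = toList-injective′ (reverse-injective (begin
    reverse (toList x)   ≡⟨ prefix-of-length (load-prefix x) (fills x) ⟩
    toList (load x)      ≡⟨ prefix-of-length popped (fills y) ⟨
    reverse (toList y)   ∎))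
    where
    open ≡-Reasoning
    fills : ∀ z → length (reverse (toList z)) ≡ length (toList (load x))
    fills z = trans (length-reverse-toList z) (sym (length-toList (load x)))
    popped : Prefix _≡_ (reverse (toList y)) (toList (load x))
    popped = popAll-prefix⁻ (reverse (toList y)) (load x) (trans (sym (steps-sampleWord x y)) ran)
               (≤-reflexive (length-reverse-toList y))

size-bound : ∀ {k} → 1 ≤ k → suc (k + suc k) * 2 ^ k ≤ 4 * (2 ^ k * 2 ^ k * k)
size-bound {k@(suc k′)} _ = begin
  suc (k + suc k) * 2 ^ k   ≤⟨ *-monoˡ-≤ (2 ^ k) layers≤4k ⟩
  4 * k * 2 ^ k             ≤⟨ m≤m*n (4 * k * 2 ^ k) (2 ^ k) {{m^n≢0 2 k}} ⟩
  4 * k * 2 ^ k * 2 ^ k     ≡⟨ rearrange k (2 ^ k) ⟩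
  4 * (2 ^ k * 2 ^ k * k)   ∎
  where
  open ≤-Reasoning
  count : ∀ m → suc (suc m + suc (suc m)) + (m + m) ≡ 4 * suc m
  count = solve-∀
  layers≤4k : suc (k + suc k) ≤ 4 * k
  layers≤4k = subst (suc (k + suc k) ≤_) (count k′) (m≤m+n (suc (k + suc k)) (k′ + k′))
  rearrange : ∀ a P → 4 * a * P * P ≡ 4 * (P * P * a)
  rearrange = solve-∀

lemma5p5 : Σ ℕ λ C → Σ ℕ λ N → (k : ℕ) → N ≤ k →
    (G : Graph (2 ^ k)) → (enc : Fin (2 ^ k) → Vec Bool k) → Injective _≡_ _≡_ enc →
    OptAtMost G enc (C * ((2 ^ k) * (2 ^ k) * k))
lemma5p5 = 4 , 1 , λ k 1≤k G enc enc-injective →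
  let open Palindrome k in
  _ , size-bound 1≤k , automaton , canonical step-live ,
  (λ u → accepts-diagonal (enc u)) ,
  (λ u v uv accepted →
     Graph.irrefl G (subst (Graph.Adj G u) (sym (enc-injective (accepts⇒≡ (enc u) (enc v) accepted))) uv))
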